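{- Let $d\in\mathbb{N}$, $D_E^{\mathrm{s}}=D_V^{\mathrm{s}}=\mathrm{Vect}(\mathbb{N}^{d+1})$, $\lambda=(1,\dots,1)$ and $\phi=\phi^\lambda$ given by $\phi(a\otimes b)=\sum_{l\leq\min(a,b)}\binom{b}{l}(a-l)\otimes(b-l)$ for $a,b\in\mathbb{N}^{d+1}$. Let $P=\mathrm{Vect}(X_i\mid 0\leq i\leq d)$ and define linear maps $\psi_V:P\to\mathrm{End}(D_V^{\mathrm{s}})$, $\psi_E:P\to\mathrm{End}(D_E^{\mathrm{s}})$ by $\psi_V(X_i)(b)=b+\epsilon^{(i)}$ and $\psi_E(X_i)(a)=a-\epsilon^{(i)}$ for $a,b\in\mathbb{N}^{d+1}$ (with $a-\epsilon^{(i)}=0$ if $a_i=0$). Then $(\psi_E,\psi_V)$ is $\phi$-compatible, i.e. for all $p,p'\in P$: $\psi_E(p')\circ\psi_E(p)=\psi_E(p)\circ\psi_E(p')$, $\psi_V(p)\circ\psi_V(p')=\psi_V(p')\circ\psi_V(p)$, and $\phi\circ(\psi_E(p)\otimes\mathrm{Id})=\phi\circ(\mathrm{Id}\otimes\psi_V(p))-(\mathrm{Id}\otimes\psi_V(p))\circ\phi$.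
   Context: $\mathbb{K}$ is a field of characteristic zero. $\epsilon^{(i)}\in\mathbb{N}^{d+1}$ has $\epsilon^{(i)}_j=\delta_{i,j}$. On $\mathbb{N}^{d+1}$, $l\leq b$ and $\min$ are componentwise, $\binom{b}{l}=\prod_j\binom{b_j}{l_j}$. -}

module Defs where

open import Level using (Level)
open import Data.Nat as ℕ using (ℕ; zero; suc; _∸_; _⊓_)
open import Data.Nat.Combinatorics using (_C_)
open import Data.Fin using (Fin)
open import Data.Vec as Vec using (Vec; []; _∷_; lookup; _[_]≔_; zipWith; updateAt)
open import Data.List as List using (List; []; _∷_; _++_; concatMap; map; foldr; cartesianProductWith; upTo)
open import Data.Product using (_×_; _,_; ∃)
open import Relation.Binary.PropositionalEquality using (_≡_)
open import Relation.Nullary using (¬_; Dec; yes; no)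
open import Relation.Binary.Definitions using (DecidableEquality)
import Data.Vec.Properties as VecP
import Data.Product.Properties as ProdP
open import Algebra.Bundles using (CommutativeRing)

module _ {c ℓ : Level} (K : CommutativeRing c ℓ) where
  open CommutativeRing K

  natR : ℕ → Carrier
  natR zero    = 0#
  natR (suc n) = 1# + natR n

  record IsCharZeroField : Set (c Level.⊔ ℓ) where
    field
      nontrivial   : ¬ (1# ≈ 0#)
      inverse      : ∀ x → ¬ (x ≈ 0#) → ∃ λ y → x * y ≈ 1#
      charZero     : ∀ n → natR n ≈ 0# → n ≡ 0

-- Vect(B): free K-vector space on a basis B, as formal finite linear
-- combinations (lists of coefficient/basis-element pairs), compared
-- extensionally by their coefficient functions.

module FreeVect {c ℓ : Level} (K : CommutativeRing c ℓ) where
  open CommutativeRing K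

  Vect : Set → Set c
  Vect B = List (Carrier × B)

  ⟪_⟫ : {B : Set} → B → Vect B
  ⟪ b ⟫ = (1# , b) ∷ []

  zeroV : {B : Set} → Vect B
  zeroV = []

  _⊕_ : {B : Set} → Vect B → Vect B → Vect B
  _⊕_ = _++_

  _·_ : {B : Set} → Carrier → Vect B → Vect B
  k · v = map (λ { (a , b) → (k * a , b) }) v

  ⊖_ : {B : Set} → Vect B → Vect B
  ⊖ v = map (λ { (a , b) → (- a , b) }) v

  _⊖_ : {B : Set} → Vect B → Vect B → Vect B
  v ⊖ w = v ⊕ (⊖ w)

  coeff : {B : Set} → DecidableEquality B → Vect B → B → Carrier
  coeff _≟_ [] b = 0#
  coeff _≟_ ((a , b′) ∷ v) b with b′ ≟ b
  ... | yes _ = a + coeff _≟_ v b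
  ... | no  _ = coeff _≟_ v b

  EqV : {B : Set} → DecidableEquality B → Vect B → Vect B → Set ℓ
  EqV _≟_ v w = ∀ b → coeff _≟_ v b ≈ coeff _≟_ w b

  linExt : {B C : Set} → (B → Vect C) → Vect B → Vect C
  linExt f v = concatMap (λ { (a , b) → a · f b }) v

  -- linear maps on the tensor product Vect(B) ⊗ Vect(C) ≅ Vect(B × C)
  -- of the form f ⊗ Id and Id ⊗ g (f, g given as linear endomorphisms)
  tensorL : {B C : Set} → (Vect B → Vect B) → Vect (B × C) → Vect (B × C)
  tensorL f = linExt (λ { (b , c) → map (λ { (a , b′) → (a , (b′ , c)) }) (f ⟪ b ⟫) })

  tensorR : {B C : Set} → (Vect C → Vect C) → Vect (B × C) → Vect (B × C)
  tensorR g = linExt (λ { (b , c) → map (λ { (a , c′) → (a , (b , c′)) }) (g ⟪ c ⟫) })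

Idx : ℕ → Set
Idx d = Vec ℕ (suc d)

_≟Idx_ : {d : ℕ} → DecidableEquality (Idx d)
_≟Idx_ = VecP.≡-dec ℕ._≟_

_≟Pair_ : {d : ℕ} → DecidableEquality (Idx d × Idx d)
_≟Pair_ = ProdP.≡-dec _≟Idx_ _≟Idx_

minV : {n : ℕ} → Vec ℕ n → Vec ℕ n → Vec ℕ n
minV = zipWith _⊓_

subV : {n : ℕ} → Vec ℕ n → Vec ℕ n → Vec ℕ n
subV = zipWith _∸_

binomV : {n : ℕ} → Vec ℕ n → Vec ℕ n → ℕ
binomV [] [] = 1
binomV (b ∷ bs) (l ∷ ls) = (b C l) ℕ.* binomV bs ls

below : {n : ℕ} → Vec ℕ n → List (Vec ℕ n)
below [] = [] ∷ []
below (m ∷ ms) = cartesianProductWith _∷_ (upTo (suc m)) (below ms)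

unitV : {d : ℕ} → Fin (suc d) → Idx d
unitV i = Vec.replicate _ 0 [ i ]≔ 1

addV : {n : ℕ} → Vec ℕ n → Vec ℕ n → Vec ℕ n
addV = zipWith ℕ._+_

module Maps {c ℓ : Level} (K : CommutativeRing c ℓ) (d : ℕ) where
  open CommutativeRing K
  open FreeVect K public

  D : Set c
  D = Vect (Idx d)

  P : Set c
  P = Vect (Fin (suc d))

  D⊗D : Set c
  D⊗D = Vect (Idx d × Idx d)

  _≈D_ : D → D → Set ℓ
  _≈D_ = EqV _≟Idx_

  _≈T_ : D⊗D → D⊗D → Set ℓ
  _≈T_ = EqV _≟Pair_

  φ : D⊗D → D⊗D
  φ = linExt (λ { (a , b) →
        map (λ l → (natR K (binomV b l) , (subV a l , subV b l))) (below (minV a b)) })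

  ψVgen : Fin (suc d) → Idx d → D
  ψVgen i b = ⟪ addV b (unitV i) ⟫

  ψEgen : Fin (suc d) → Idx d → D
  ψEgen i a with lookup a i
  ... | zero  = zeroV
  ... | suc _ = ⟪ subV a (unitV i) ⟫

  ψV : P → D → D
  ψV p v = linExt (λ i → linExt (ψVgen i) v) p

  ψE : P → D → D
  ψE p v = linExt (λ i → linExt (ψEgen i) v) p

  Id : D → D
  Id v = v

-- Everything is tested against functions on the basis: two vectors are equal iff their pairings
-- with all test functions agree, and a map defined on basis vectors acts on test functions by
-- transposition.  The ψE (resp. ψV) then commute because lowering (raising) two coordinates can be
-- done in either order.  For the third identity, pairing with a product test function
-- ∏ⱼ Fⱼ(uⱼ, vⱼ), a family that still contains the indicators of basis vectors, turns the pairing of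
-- φ(a ⊗ b) into a product over coordinates of the sums Σₗ C(bⱼ,l) Fⱼ(aⱼ − l, bⱼ − l).  The identity
-- therefore reduces to a single coordinate, where it is Pascal's rule C(b+1,l+1) = C(b,l) + C(b,l+1).
module Submission where

open import Defs
open import Level using (Level)
open import Data.Nat using (ℕ)
open import Data.Product using (_×_)
open import Algebra.Bundles using (CommutativeRing)

open import Data.Nat as ℕ using (zero; suc; _∸_; _⊓_; _≤_; _<_)
import Data.Nat.Properties as ℕP
open import Data.Nat.Combinatorics using (_C_; k>n⇒nCk≡0; nCk+nC[k+1]≡[n+1]C[k+1])
open import Data.Fin as Fin using (Fin)
open import Data.Vec as Vec using (Vec; []; _∷_; lookup; replicate; zipWith; _[_]≔_; _[_]%=_)
import Data.Vec.Properties as VecP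
open import Data.List as List using (List; []; _∷_; _++_; concatMap; cartesianProductWith; applyUpTo)
open import Data.Maybe as Maybe using (Maybe; just; nothing; _>>=_; maybe′)
open import Data.Product using (_,_; proj₁; proj₂)
import Data.Product.Properties as ProdP
open import Function using (_∘_; id)
open import Relation.Binary.Definitions using (DecidableEquality)
import Relation.Binary.PropositionalEquality as ≡
open import Relation.Binary.PropositionalEquality using (_≡_; _≢_)
open import Relation.Nullary using (yes; no; contradiction)
import Algebra.Properties.CommutativeSemigroup ℕP.+-commutativeSemigroup as ℕ+

unit : ∀ {n} → Fin n → Vec ℕ n
unit {n} i = replicate n 0 [ i ]≔ 1

subV-identityʳ : ∀ {n} (a : Vec ℕ n) → subV a (replicate n 0) ≡ a
subV-identityʳ = VecP.zipWith-identityʳ λ _ → ≡.refl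

addV-identityʳ : ∀ {n} (a : Vec ℕ n) → addV a (replicate n 0) ≡ a
addV-identityʳ = VecP.zipWith-identityʳ ℕP.+-identityʳ

zipWith-rightComm : ∀ {a} {A : Set a} {n} (f : A → A → A) → (∀ x y z → f (f x y) z ≡ f (f x z) y) →
                    (xs ys zs : Vec A n) → zipWith f (zipWith f xs ys) zs ≡ zipWith f (zipWith f xs zs) ys
zipWith-rightComm f comm []       []       []       = ≡.refl
zipWith-rightComm f comm (x ∷ xs) (y ∷ ys) (z ∷ zs) =
  ≡.cong₂ _∷_ (comm x y z) (zipWith-rightComm f comm xs ys zs)

m∸n∸o≡m∸o∸n : ∀ m n o → m ∸ n ∸ o ≡ m ∸ o ∸ n
m∸n∸o≡m∸o∸n m n o = ≡.trans (ℕP.∸-+-assoc m n o)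
  (≡.trans (≡.cong (m ∸_) (ℕP.+-comm n o)) (≡.sym (ℕP.∸-+-assoc m o n)))

addV-unit-zero : ∀ {n} b₀ (b : Vec ℕ n) → addV (b₀ ∷ b) (unit Fin.zero) ≡ suc b₀ ∷ b
addV-unit-zero b₀ b = ≡.cong₂ _∷_ (ℕP.+-comm b₀ 1) (addV-identityʳ b)

addV-unit-suc : ∀ {n} (i : Fin n) b₀ b → addV (b₀ ∷ b) (unit (Fin.suc i)) ≡ b₀ ∷ addV b (unit i)
addV-unit-suc i b₀ b = ≡.cong (_∷ addV b (unit i)) (ℕP.+-identityʳ b₀)

lookup-subV-unit : ∀ {n} {i j : Fin n} (a : Vec ℕ n) → i ≢ j → lookup (subV a (unit j)) i ≡ lookup a i
lookup-subV-unit {n} {i} {j} a i≢j = ≡.trans (VecP.lookup-zipWith _∸_ i a (unit j))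
  (≡.cong (lookup a i ∸_) (≡.trans (VecP.lookup∘update′ i≢j (replicate n 0) 1) (VecP.lookup-replicate i 0)))

-- ψE(Xᵢ) on a basis vector, with nothing standing for the zero vector.
lower : ∀ {n} → Fin n → Vec ℕ n → Maybe (Vec ℕ n)
lower i a with lookup a i
... | zero  = nothing
... | suc _ = just (subV a (unit i))

lower-comm : ∀ {n} (i j : Fin n) (a : Vec ℕ n) → (lower i a >>= lower j) ≡ (lower j a >>= lower i)
lower-comm i j a with i Fin.≟ j
... | yes ≡.refl = ≡.refl
... | no i≢j with lookup a i in aᵢ | lookup a j in aⱼ
... | zero  | zero  = ≡.refl
... | zero  | suc _ rewrite lookup-subV-unit a i≢j | aᵢ = ≡.refl
... | suc _ | zero  rewrite lookup-subV-unit a (≡.≢-sym i≢j) | aⱼ = ≡.refl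
... | suc _ | suc _ rewrite lookup-subV-unit a i≢j | lookup-subV-unit a (≡.≢-sym i≢j) | aᵢ | aⱼ =
  ≡.cong just (zipWith-rightComm _∸_ m∸n∸o≡m∸o∸n a (unit i) (unit j))

lower-suc : ∀ {n} (i : Fin n) a₀ a → lower (Fin.suc i) (a₀ ∷ a) ≡ Maybe.map (a₀ ∷_) (lower i a)
lower-suc i a₀ a with lookup a i
... | zero  = ≡.refl
... | suc _ = ≡.refl

_≟ℕ²_ : DecidableEquality (ℕ × ℕ)
_≟ℕ²_ = ProdP.≡-dec ℕ._≟_ ℕ._≟_

_≟Vec²_ : ∀ {n} → DecidableEquality (Vec ℕ n × Vec ℕ n)
_≟Vec²_ = ProdP.≡-dec (VecP.≡-dec ℕ._≟_) (VecP.≡-dec ℕ._≟_)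

module ListSum {c ℓ : Level} (K : CommutativeRing c ℓ) where
  open CommutativeRing K
  open import Relation.Binary.Reasoning.Setoid setoid
  open import Algebra.Properties.AbelianGroup +-abelianGroup using (⁻¹-∙-comm; ε⁻¹≈ε)
  open import Algebra.Properties.CommutativeSemigroup +-commutativeSemigroup
    using () renaming (interchange to +-interchange)

  private variable
    a b : Level
    A : Set a
    B : Set b

  ∑ : List A → (A → Carrier) → Carrier
  ∑ []       w = 0#
  ∑ (x ∷ xs) w = w x + ∑ xs w

  ∑-cong : (xs : List A) {f g : A → Carrier} → (∀ x → f x ≈ g x) → ∑ xs f ≈ ∑ xs g
  ∑-cong []       f≈g = refl
  ∑-cong (x ∷ xs) f≈g = +-cong (f≈g x) (∑-cong xs f≈g)

  ∑-++ : (xs ys : List A) (w : A → Carrier) → ∑ (xs ++ ys) w ≈ ∑ xs w + ∑ ys w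
  ∑-++ []       ys w = sym (+-identityˡ _)
  ∑-++ (x ∷ xs) ys w = trans (+-cong refl (∑-++ xs ys w)) (sym (+-assoc _ _ _))

  ∑-map : (g : A → B) (xs : List A) (w : B → Carrier) → ∑ (List.map g xs) w ≡ ∑ xs (w ∘ g)
  ∑-map g []       w = ≡.refl
  ∑-map g (x ∷ xs) w = ≡.cong (w (g x) +_) (∑-map g xs w)

  ∑-concatMap : (g : A → List B) (xs : List A) (w : B → Carrier) →
                ∑ (concatMap g xs) w ≈ ∑ xs (λ x → ∑ (g x) w)
  ∑-concatMap g []       w = refl
  ∑-concatMap g (x ∷ xs) w = trans (∑-++ (g x) (concatMap g xs) w) (+-cong refl (∑-concatMap g xs w))

  ∑-0 : (xs : List A) → ∑ xs (λ _ → 0#) ≈ 0#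
  ∑-0 []       = refl
  ∑-0 (x ∷ xs) = trans (+-identityˡ _) (∑-0 xs)

  ∑-+ : (xs : List A) (f g : A → Carrier) → ∑ xs (λ x → f x + g x) ≈ ∑ xs f + ∑ xs g
  ∑-+ []       f g = sym (+-identityˡ 0#)
  ∑-+ (x ∷ xs) f g = trans (+-cong refl (∑-+ xs f g)) (+-interchange _ _ _ _)

  ∑-neg : (xs : List A) (f : A → Carrier) → ∑ xs (λ x → - f x) ≈ - ∑ xs f
  ∑-neg []       f = sym ε⁻¹≈ε
  ∑-neg (x ∷ xs) f = trans (+-cong refl (∑-neg xs f)) (⁻¹-∙-comm _ _)

  ∑-- : (xs : List A) (f g : A → Carrier) → ∑ xs (λ x → f x - g x) ≈ ∑ xs f - ∑ xs g
  ∑-- xs f g = trans (∑-+ xs f (λ x → - g x)) (+-cong refl (∑-neg xs g))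

  ∑-*ˡ : (xs : List A) (k : Carrier) (f : A → Carrier) → ∑ xs (λ x → k * f x) ≈ k * ∑ xs f
  ∑-*ˡ []       k f = sym (zeroʳ k)
  ∑-*ˡ (x ∷ xs) k f = trans (+-cong refl (∑-*ˡ xs k f)) (sym (distribˡ k _ _))

  ∑-swap : (xs : List A) (ys : List B) (h : A → B → Carrier) →
           ∑ xs (λ x → ∑ ys (h x)) ≈ ∑ ys (λ y → ∑ xs (λ x → h x y))
  ∑-swap []       ys h = sym (∑-0 ys)
  ∑-swap (x ∷ xs) ys h = trans (+-cong refl (∑-swap xs ys h)) (sym (∑-+ ys (h x) _))

  ∑-cartesianProductWith : {C : Set} (f : A → B → C) (xs : List A) (ys : List B)
    {w : C → Carrier} {u : A → Carrier} {v : B → Carrier} → (∀ x y → w (f x y) ≈ u x * v y) →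
    ∑ (cartesianProductWith f xs ys) w ≈ ∑ xs u * ∑ ys v
  ∑-cartesianProductWith f []       ys w≈uv = sym (zeroˡ _)
  ∑-cartesianProductWith f (x ∷ xs) ys {w} {u} {v} w≈uv = begin
    ∑ (List.map (f x) ys ++ cartesianProductWith f xs ys) w
      ≈⟨ ∑-++ (List.map (f x) ys) _ w ⟩
    ∑ (List.map (f x) ys) w + ∑ (cartesianProductWith f xs ys) w
      ≈⟨ +-cong (reflexive (∑-map (f x) ys w)) (∑-cartesianProductWith f xs ys w≈uv) ⟩
    ∑ ys (λ y → w (f x y)) + ∑ xs u * ∑ ys v
      ≈⟨ +-cong (trans (∑-cong ys (w≈uv x)) (∑-*ˡ ys (u x) v)) refl ⟩
    u x * ∑ ys v + ∑ xs u * ∑ ys v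
      ≈⟨ distribʳ _ _ _ ⟨
    (u x + ∑ xs u) * ∑ ys v ∎

  ∑< : ℕ → (ℕ → Carrier) → Carrier
  ∑< zero    f = 0#
  ∑< (suc n) f = f 0 + ∑< n (f ∘ suc)

  ∑-applyUpTo : ∀ (g : ℕ → A) n (f : A → Carrier) → ∑ (applyUpTo g n) f ≡ ∑< n (f ∘ g)
  ∑-applyUpTo g zero    f = ≡.refl
  ∑-applyUpTo g (suc n) f = ≡.cong (f (g 0) +_) (∑-applyUpTo (g ∘ suc) n f)

  ∑<-cong : ∀ n {f g : ℕ → Carrier} → (∀ l → f l ≈ g l) → ∑< n f ≈ ∑< n g
  ∑<-cong zero    f≈g = refl
  ∑<-cong (suc n) f≈g = +-cong (f≈g 0) (∑<-cong n (f≈g ∘ suc))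

  ∑<-+ : ∀ n (f g : ℕ → Carrier) → ∑< n (λ l → f l + g l) ≈ ∑< n f + ∑< n g
  ∑<-+ zero    f g = sym (+-identityˡ 0#)
  ∑<-+ (suc n) f g = trans (+-cong refl (∑<-+ n _ _)) (+-interchange _ _ _ _)

  ∑<-vanishing : ∀ n (f : ℕ → Carrier) → (∀ l → l < n → f l ≈ 0#) → ∑< n f ≈ 0#
  ∑<-vanishing zero    f f≈0 = refl
  ∑<-vanishing (suc n) f f≈0 =
    trans (+-cong (f≈0 0 ℕ.z<s) (∑<-vanishing n _ (λ l l<n → f≈0 (suc l) (ℕ.s<s l<n)))) (+-identityˡ 0#)

  ∑<-extend : ∀ {m n} (f : ℕ → Carrier) → m ≤ n → (∀ l → m < l → l ≤ n → f l ≈ 0#) →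
              ∑< (suc m) f ≈ ∑< (suc n) f
  ∑<-extend {zero}  {n}     f _           f≈0 =
    +-cong refl (sym (∑<-vanishing n _ (λ l l<n → f≈0 (suc l) ℕ.z<s l<n)))
  ∑<-extend {suc m} {suc n} f (ℕ.s≤s m≤n) f≈0 =
    +-cong refl (∑<-extend _ m≤n (λ l m<l l≤n → f≈0 (suc l) (ℕ.s<s m<l) (ℕ.s≤s l≤n)))

module Pairing {c ℓ : Level} (K : CommutativeRing c ℓ) where
  open CommutativeRing K
  open FreeVect K
  open ListSum K
  open import Relation.Binary.Reasoning.Setoid setoid
  open import Algebra.Properties.Ring ring using (-‿distribˡ-*; x[y-z]≈xy-xz)
  open import Algebra.Properties.CommutativeSemigroup *-commutativeSemigroup using (x∙yz≈y∙xz)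

  private variable
    B C I : Set

  pair : Vect B → (B → Carrier) → Carrier
  pair v h = ∑ v (λ (k , b) → k * h b)

  pair-cong : (v : Vect B) {h h′ : B → Carrier} → (∀ b → h b ≈ h′ b) → pair v h ≈ pair v h′
  pair-cong v h≈h′ = ∑-cong v (λ (k , b) → *-cong refl (h≈h′ b))

  pair-⟪⟫ : (b : B) (h : B → Carrier) → pair ⟪ b ⟫ h ≈ h b
  pair-⟪⟫ b h = trans (+-identityʳ _) (*-identityˡ _)

  pair-· : (k : Carrier) (v : Vect B) (h : B → Carrier) → pair (k · v) h ≈ k * pair v h
  pair-· k v h = begin
    pair (k · v) h                   ≡⟨ ∑-map _ v _ ⟩
    ∑ v (λ (a , b) → k * a * h b)   ≈⟨ ∑-cong v (λ (a , b) → *-assoc k a (h b)) ⟩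
    ∑ v (λ (a , b) → k * (a * h b)) ≈⟨ ∑-*ˡ v k _ ⟩
    k * pair v h                     ∎

  pair-⊖ : (v w : Vect B) (h : B → Carrier) → pair (v ⊖ w) h ≈ pair v h - pair w h
  pair-⊖ v w h = trans (∑-++ v (⊖ w) _) (+-cong refl (begin
    pair (⊖ w) h                  ≡⟨ ∑-map _ w _ ⟩
    ∑ w (λ (a , b) → - a * h b)   ≈⟨ ∑-cong w (λ (a , b) → -‿distribˡ-* a (h b)) ⟨
    ∑ w (λ (a , b) → - (a * h b)) ≈⟨ ∑-neg w _ ⟩
    - pair w h                    ∎))

  pair-- : (v : Vect B) (f g : B → Carrier) → pair v (λ b → f b - g b) ≈ pair v f - pair v g
  pair-- v f g = trans (∑-cong v (λ (k , b) → x[y-z]≈xy-xz k (f b) (g b))) (∑-- v _ _)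

  pair-swap : (u : Vect B) (w : Vect C) (h : B → C → Carrier) →
              pair u (λ x → pair w (h x)) ≈ pair w (λ y → pair u (λ x → h x y))
  pair-swap u w h = begin
    ∑ u (λ (k , x) → k * ∑ w (λ (k′ , y) → k′ * h x y))
      ≈⟨ ∑-cong u (λ (k , x) → ∑-*ˡ w k _) ⟨
    ∑ u (λ (k , x) → ∑ w (λ (k′ , y) → k * (k′ * h x y)))
      ≈⟨ ∑-swap u w _ ⟩
    ∑ w (λ (k′ , y) → ∑ u (λ (k , x) → k * (k′ * h x y)))
      ≈⟨ ∑-cong w (λ (k′ , y) → ∑-cong u (λ (k , x) → x∙yz≈y∙xz k k′ (h x y))) ⟩
    ∑ w (λ (k′ , y) → ∑ u (λ (k , x) → k′ * (k * h x y)))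
      ≈⟨ ∑-cong w (λ (k′ , y) → ∑-*ˡ u k′ _) ⟩
    ∑ w (λ (k′ , y) → k′ * ∑ u (λ (k , x) → k * h x y)) ∎

  pair-linExt : (f : B → Vect C) (v : Vect B) (h : C → Carrier) →
                pair (linExt f v) h ≈ pair v (λ b → pair (f b) h)
  pair-linExt f v h = trans (∑-concatMap _ v _) (∑-cong v (λ (a , b) → pair-· a (f b) h))

  pair-tensorL : (f : Vect B → Vect B) (t : Vect (B × C)) (h : B × C → Carrier) →
                 pair (tensorL f t) h ≈ pair t (λ (b , c) → pair (f ⟪ b ⟫) (λ b′ → h (b′ , c)))
  pair-tensorL f t h = trans (pair-linExt _ t h) (pair-cong t (λ (b , c) → reflexive (∑-map _ (f ⟪ b ⟫) _)))

  pair-tensorR : (g : Vect C → Vect C) (t : Vect (B × C)) (h : B × C → Carrier) →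
                 pair (tensorR g t) h ≈ pair t (λ (b , c) → pair (g ⟪ c ⟫) (λ c′ → h (b , c′)))
  pair-tensorR g t h = trans (pair-linExt _ t h) (pair-cong t (λ (b , c) → reflexive (∑-map _ (g ⟪ c ⟫) _)))

  -- ψE p and ψV p are definitionally linAct ψEgen p and linAct ψVgen p.
  linAct : (I → B → Vect B) → Vect I → Vect B → Vect B
  linAct g p v = linExt (λ i → linExt (g i) v) p

  pair-linAct : (g : I → B → Vect B) (p : Vect I) (v : Vect B) (h : B → Carrier) →
                pair (linAct g p v) h ≈ pair p (λ i → pair v (λ b → pair (g i b) h))
  pair-linAct g p v h = trans (pair-linExt _ p h) (pair-cong p (λ i → pair-linExt (g i) v h))

  δ : DecidableEquality B → B → B → Carrier
  δ _≟_ b b′ with b′ ≟ b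
  ... | yes _ = 1#
  ... | no  _ = 0#

  δ-≡ : (_≟_ : DecidableEquality B) {b b′ : B} → b′ ≡ b → δ _≟_ b b′ ≈ 1#
  δ-≡ _≟_ {b} {b′} b′≡b with b′ ≟ b
  ... | yes _   = refl
  ... | no b′≢b = contradiction b′≡b b′≢b

  δ-≢ : (_≟_ : DecidableEquality B) {b b′ : B} → b′ ≢ b → δ _≟_ b b′ ≈ 0#
  δ-≢ _≟_ {b} {b′} b′≢b with b′ ≟ b
  ... | yes b′≡b = contradiction b′≡b b′≢b
  ... | no _     = refl

  δ-× : {A : Set} (_≟A_ : DecidableEquality A) (_≟B_ : DecidableEquality B) (_≟C_ : DecidableEquality C)
        {a a′ : A} {b b′ : B} {c c′ : C} →
        (a′ ≡ a → b′ ≡ b × c′ ≡ c) → (b′ ≡ b → c′ ≡ c → a′ ≡ a) →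
        δ _≟A_ a a′ ≈ δ _≟B_ b b′ * δ _≟C_ c c′
  δ-× _≟A_ _≟B_ _≟C_ {b = b} {b′} {c} {c′} split join with b′ ≟B b | c′ ≟C c
  ... | yes b′≡b | yes c′≡c = trans (δ-≡ _≟A_ (join b′≡b c′≡c)) (sym (*-identityˡ 1#))
  ... | no b′≢b  | _        = trans (δ-≢ _≟A_ (b′≢b ∘ proj₁ ∘ split)) (sym (zeroˡ _))
  ... | yes _    | no c′≢c  = trans (δ-≢ _≟A_ (c′≢c ∘ proj₂ ∘ split)) (sym (zeroʳ _))

  coeff≈pair-δ : (_≟_ : DecidableEquality B) (v : Vect B) (b : B) → coeff _≟_ v b ≈ pair v (δ _≟_ b)
  coeff≈pair-δ _≟_ []             b = refl
  coeff≈pair-δ _≟_ ((a , b′) ∷ v) b with b′ ≟ b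
  ... | yes _ = +-cong (sym (*-identityʳ a)) (coeff≈pair-δ _≟_ v b)
  ... | no  _ = trans (coeff≈pair-δ _≟_ v b) (sym (trans (+-cong (zeroʳ a) refl) (+-identityˡ _)))

  pair-δ-separates : (_≟_ : DecidableEquality B) (v w : Vect B) →
                     (∀ b → pair v (δ _≟_ b) ≈ pair w (δ _≟_ b)) → EqV _≟_ v w
  pair-δ-separates _≟_ v w v≈w b =
    trans (coeff≈pair-δ _≟_ v b) (trans (v≈w b) (sym (coeff≈pair-δ _≟_ w b)))

  linAct-comm : (_≟_ : DecidableEquality B) (g : I → B → Vect B) →
    (∀ i j b h → pair (g i b) (λ b′ → pair (g j b′) h) ≈ pair (g j b) (λ b′ → pair (g i b′) h)) →
    ∀ p p′ v → EqV _≟_ (linAct g p′ (linAct g p v)) (linAct g p (linAct g p′ v))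
  linAct-comm _≟_ g gᵢgⱼ≈gⱼgᵢ p p′ v = pair-δ-separates _≟_ (linAct g p′ (linAct g p v)) (linAct g p (linAct g p′ v))
    λ b → let h = δ _≟_ b in begin
    pair (linAct g p′ (linAct g p v)) h
      ≈⟨ pair-linAct g p′ (linAct g p v) h ⟩
    pair p′ (λ j → pair (linAct g p v) (λ b′ → pair (g j b′) h))
      ≈⟨ pair-cong p′ (λ j → pair-linAct g p v _) ⟩
    pair p′ (λ j → pair p (λ i → pair v (λ b′ → pair (g i b′) (λ b″ → pair (g j b″) h))))
      ≈⟨ pair-swap p′ p _ ⟩
    pair p (λ i → pair p′ (λ j → pair v (λ b′ → pair (g i b′) (λ b″ → pair (g j b″) h))))
      ≈⟨ pair-cong p (λ i → pair-cong p′ (λ j → pair-cong v (λ b′ → gᵢgⱼ≈gⱼgᵢ i j b′ h))) ⟩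
    pair p (λ i → pair p′ (λ j → pair v (λ b′ → pair (g j b′) (λ b″ → pair (g i b″) h))))
      ≈⟨ pair-cong p (λ i → pair-linAct g p′ v _) ⟨
    pair p (λ i → pair (linAct g p′ v) (λ b′ → pair (g i b′) h))
      ≈⟨ pair-linAct g p (linAct g p′ v) h ⟨
    pair (linAct g p (linAct g p′ v)) h ∎

module ProductTests {c ℓ : Level} (K : CommutativeRing c ℓ) where
  open CommutativeRing K
  open FreeVect K
  open ListSum K
  open Pairing K
  open import Relation.Binary.Reasoning.Setoid setoid
  open import Algebra.Properties.Ring ring using (x[y-z]≈xy-xz; [y-z]x≈yx-zx)
  open import Algebra.Properties.AbelianGroup +-abelianGroup using (//-rightDividesʳ)
  open import Algebra.Properties.CommutativeSemigroup *-commutativeSemigroup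
    using () renaming (interchange to *-interchange)
  open import Algebra.Properties.CommutativeSemigroup +-commutativeSemigroup
    using () renaming (x∙yz≈y∙xz to +-leftComm)

  -cong : ∀ {x x′ y y′} → x ≈ x′ → y ≈ y′ → x - y ≈ x′ - y′
  -cong x≈x′ y≈y′ = +-cong x≈x′ (-‿cong y≈y′)

  natR-+ : ∀ m n → natR K (m ℕ.+ n) ≈ natR K m + natR K n
  natR-+ zero    n = sym (+-identityˡ _)
  natR-+ (suc m) n = trans (+-cong refl (natR-+ m n)) (sym (+-assoc _ _ _))

  natR-* : ∀ m n → natR K (m ℕ.* n) ≈ natR K m * natR K n
  natR-* zero    n = sym (zeroˡ _)
  natR-* (suc m) n = begin
    natR K (n ℕ.+ m ℕ.* n)              ≈⟨ natR-+ n (m ℕ.* n) ⟩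
    natR K n + natR K (m ℕ.* n)         ≈⟨ +-cong (sym (*-identityˡ _)) (natR-* m n) ⟩
    1# * natR K n + natR K m * natR K n ≈⟨ distribʳ _ _ _ ⟨
    (1# + natR K m) * natR K n          ∎

  natR-C-pascal : ∀ b l → natR K (suc b C suc l) ≈ natR K (b C l) + natR K (b C suc l)
  natR-C-pascal b l = trans (reflexive (≡.cong (natR K) (≡.sym (nCk+nC[k+1]≡[n+1]C[k+1] b l))))
                            (natR-+ (b C l) (b C suc l))

  natR-C-*-cong : ∀ b l {x y} → (l ≤ b → x ≈ y) → natR K (b C l) * x ≈ natR K (b C l) * y
  natR-C-*-cong b l {x} {y} x≈y with l ℕ.≤? b
  ... | yes l≤b = *-cong refl (x≈y l≤b)
  ... | no  l≰b rewrite k>n⇒nCk≡0 (ℕP.≰⇒> l≰b) = trans (zeroˡ x) (sym (zeroˡ y))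

  -- One coordinate (aⱼ, bⱼ) of a test function on ℕ^{d+1} × ℕ^{d+1}.
  Test : Set c
  Test = ℕ → ℕ → Carrier

  raise₂ : Test → Test
  raise₂ F u v = F u (suc v)

  -- Φ a b Fs (below) is the pairing of φ(a ⊗ b) with ∏ Fs; Φ₁ is its factor for one coordinate, and
  -- Φ₁↓ a b F the one-coordinate pairing of φ(ψE(X)(a) ⊗ b), which is 0 when a = 0.
  Φ₁ : ℕ → ℕ → Test → Carrier
  Φ₁ a b F = ∑< (suc (a ⊓ b)) (λ l → natR K (b C l) * F (a ∸ l) (b ∸ l))

  Φ₁↓ : ℕ → ℕ → Test → Carrier
  Φ₁↓ zero    b F = 0#
  Φ₁↓ (suc a) b F = Φ₁ a b F

  Φ₁-unbounded : ∀ a b F → Φ₁ a b F ≈ ∑< (suc a) (λ l → natR K (b C l) * F (a ∸ l) (b ∸ l))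
  Φ₁-unbounded a b F = ∑<-extend (λ l → natR K (b C l) * F (a ∸ l) (b ∸ l)) (ℕP.m⊓n≤m a b)
    λ l a⊓b<l l≤a → trans (natR-C-*-cong b l {y = 0#}
      (λ l≤b → contradiction (ℕP.⊓-glb l≤a l≤b) (ℕP.<⇒≱ a⊓b<l))) (zeroʳ _)

  Φ₁-pascal : ∀ a b F → Φ₁ (suc a) (suc b) F ≈ Φ₁ a b F + Φ₁ (suc a) b (raise₂ F)
  Φ₁-pascal a b F = begin
    Φ₁ (suc a) (suc b) F
      ≈⟨ Φ₁-unbounded (suc a) (suc b) F ⟩
    F₀ + ∑< (suc a) (λ l → natR K (suc b C suc l) * F (a ∸ l) (b ∸ l))
      ≈⟨ +-cong refl (∑<-cong (suc a) λ l →
           trans (*-cong (natR-C-pascal b l) refl) (distribʳ (F (a ∸ l) (b ∸ l)) _ _)) ⟩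
    F₀ + ∑< (suc a) (λ l → same l + next l)
      ≈⟨ +-cong refl (∑<-+ (suc a) same next) ⟩
    F₀ + (∑< (suc a) same + ∑< (suc a) next)
      ≈⟨ +-leftComm F₀ _ _ ⟩
    ∑< (suc a) same + (F₀ + ∑< (suc a) next)
      ≈⟨ +-cong (Φ₁-unbounded a b F) (+-cong refl (∑<-cong (suc a) λ l → natR-C-*-cong b (suc l) λ l<b →
           reflexive (≡.cong (F (a ∸ l)) (≡.sym (ℕP.+-∸-assoc 1 l<b))))) ⟨
    Φ₁ a b F + ∑< (suc (suc a)) (λ l → natR K (b C l) * raise₂ F (suc a ∸ l) (b ∸ l))
      ≈⟨ +-cong refl (Φ₁-unbounded (suc a) b (raise₂ F)) ⟨
    Φ₁ a b F + Φ₁ (suc a) b (raise₂ F) ∎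
    where
      -- b C 0 and suc b C 0 both compute to 1, so F₀ is the l = 0 term of both outer sums.
      F₀ = natR K (b C 0) * F (suc a) (suc b)
      same next : ℕ → Carrier
      same l = natR K (b C l) * F (a ∸ l) (b ∸ l)
      next l = natR K (b C suc l) * F (a ∸ l) (b ∸ l)

  Φ₁-lower : ∀ a b F → Φ₁↓ a b F ≈ Φ₁ a (suc b) F - Φ₁ a b (raise₂ F)
  Φ₁-lower zero    b F = sym (-‿inverseʳ _)
  Φ₁-lower (suc a) b F = sym (trans (+-cong (Φ₁-pascal a b F) refl) (//-rightDividesʳ _ _))

  ∏ : ∀ {n} → Vec Test n → Vec ℕ n × Vec ℕ n → Carrier
  ∏ []       ([]     , [])     = 1#
  ∏ (F ∷ Fs) (u ∷ us , v ∷ vs) = F u v * ∏ Fs (us , vs)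

  Φ : ∀ {n} → Vec ℕ n → Vec ℕ n → Vec Test n → Carrier
  Φ a b Fs = ∑ (below (minV a b)) (λ l → natR K (binomV b l) * ∏ Fs (subV a l , subV b l))

  Φ-∷ : ∀ {n} a₀ (a : Vec ℕ n) b₀ b F Fs → Φ (a₀ ∷ a) (b₀ ∷ b) (F ∷ Fs) ≈ Φ₁ a₀ b₀ F * Φ a b Fs
  Φ-∷ a₀ a b₀ b F Fs =
    trans (∑-cartesianProductWith _∷_ (applyUpTo id (suc (a₀ ⊓ b₀))) (below (minV a b))
             (λ l₀ l → trans (*-cong (natR-* (b₀ C l₀) (binomV b l)) refl) (*-interchange _ _ _ _)))
          (*-cong (reflexive (∑-applyUpTo id (suc (a₀ ⊓ b₀)) _)) refl)

  ∏-raise : ∀ {n} (i : Fin n) Fs (u v : Vec ℕ n) → ∏ Fs (u , addV v (unit i)) ≡ ∏ (Fs [ i ]%= raise₂) (u , v)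
  ∏-raise Fin.zero    (F ∷ Fs) (u₀ ∷ u) (v₀ ∷ v) =
    ≡.cong₂ (λ v₀′ v′ → F u₀ v₀′ * ∏ Fs (u , v′)) (ℕP.+-comm v₀ 1) (addV-identityʳ v)
  ∏-raise (Fin.suc i) (F ∷ Fs) (u₀ ∷ u) (v₀ ∷ v) =
    ≡.cong₂ (λ v₀′ r → F u₀ v₀′ * r) (ℕP.+-identityʳ v₀) (∏-raise i Fs u v)

  Φ-lower-zero : ∀ {n} a₀ (a : Vec ℕ n) b₀ b F Fs →
                 maybe′ (λ a′ → Φ a′ (b₀ ∷ b) (F ∷ Fs)) 0# (lower Fin.zero (a₀ ∷ a))
                 ≈ Φ₁↓ a₀ b₀ F * Φ a b Fs
  Φ-lower-zero zero     a b₀ b F Fs = sym (zeroˡ _)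
  Φ-lower-zero (suc a₀) a b₀ b F Fs =
    trans (reflexive (≡.cong (λ a′ → Φ (a₀ ∷ a′) (b₀ ∷ b) (F ∷ Fs)) (subV-identityʳ a)))
          (Φ-∷ a₀ a b₀ b F Fs)

  Φ-lower-suc : ∀ {n} (i : Fin n) a₀ a b₀ b F Fs →
                maybe′ (λ a′ → Φ a′ (b₀ ∷ b) (F ∷ Fs)) 0# (lower (Fin.suc i) (a₀ ∷ a))
                ≈ Φ₁ a₀ b₀ F * maybe′ (λ a′ → Φ a′ b Fs) 0# (lower i a)
  Φ-lower-suc i a₀ a b₀ b F Fs rewrite lower-suc i a₀ a with lower i a
  ... | nothing = sym (zeroʳ _)
  ... | just a′ = Φ-∷ a₀ a′ b₀ b F Fs

  Φ-lower : ∀ {n} (i : Fin n) a b Fs →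
            maybe′ (λ a′ → Φ a′ b Fs) 0# (lower i a) ≈ Φ a (addV b (unit i)) Fs - Φ a b (Fs [ i ]%= raise₂)
  Φ-lower Fin.zero (a₀ ∷ a) (b₀ ∷ b) (F ∷ Fs) = begin
    maybe′ (λ a′ → Φ a′ (b₀ ∷ b) (F ∷ Fs)) 0# (lower Fin.zero (a₀ ∷ a))
      ≈⟨ Φ-lower-zero a₀ a b₀ b F Fs ⟩
    Φ₁↓ a₀ b₀ F * Φ a b Fs
      ≈⟨ *-cong (Φ₁-lower a₀ b₀ F) refl ⟩
    (Φ₁ a₀ (suc b₀) F - Φ₁ a₀ b₀ (raise₂ F)) * Φ a b Fs
      ≈⟨ [y-z]x≈yx-zx _ _ _ ⟩
    Φ₁ a₀ (suc b₀) F * Φ a b Fs - Φ₁ a₀ b₀ (raise₂ F) * Φ a b Fs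
      ≈⟨ -cong (Φ-∷ a₀ a (suc b₀) b F Fs) (Φ-∷ a₀ a b₀ b (raise₂ F) Fs) ⟨
    Φ (a₀ ∷ a) (suc b₀ ∷ b) (F ∷ Fs) - Φ (a₀ ∷ a) (b₀ ∷ b) (raise₂ F ∷ Fs)
      ≡⟨ ≡.cong (λ b′ → Φ (a₀ ∷ a) b′ (F ∷ Fs) - Φ (a₀ ∷ a) (b₀ ∷ b) (raise₂ F ∷ Fs))
                (addV-unit-zero b₀ b) ⟨
    Φ (a₀ ∷ a) (addV (b₀ ∷ b) (unit Fin.zero)) (F ∷ Fs) - Φ (a₀ ∷ a) (b₀ ∷ b) (raise₂ F ∷ Fs) ∎
  Φ-lower (Fin.suc i) (a₀ ∷ a) (b₀ ∷ b) (F ∷ Fs) = begin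
    maybe′ (λ a′ → Φ a′ (b₀ ∷ b) (F ∷ Fs)) 0# (lower (Fin.suc i) (a₀ ∷ a))
      ≈⟨ Φ-lower-suc i a₀ a b₀ b F Fs ⟩
    Φ₁ a₀ b₀ F * maybe′ (λ a′ → Φ a′ b Fs) 0# (lower i a)
      ≈⟨ *-cong refl (Φ-lower i a b Fs) ⟩
    Φ₁ a₀ b₀ F * (Φ a (addV b (unit i)) Fs - Φ a b Fsᵢ)
      ≈⟨ x[y-z]≈xy-xz _ _ _ ⟩
    Φ₁ a₀ b₀ F * Φ a (addV b (unit i)) Fs - Φ₁ a₀ b₀ F * Φ a b Fsᵢ
      ≈⟨ -cong (Φ-∷ a₀ a b₀ (addV b (unit i)) F Fs) (Φ-∷ a₀ a b₀ b F Fsᵢ) ⟨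
    Φ (a₀ ∷ a) (b₀ ∷ addV b (unit i)) (F ∷ Fs) - Φ (a₀ ∷ a) (b₀ ∷ b) (F ∷ Fsᵢ)
      ≡⟨ ≡.cong (λ b′ → Φ (a₀ ∷ a) b′ (F ∷ Fs) - Φ (a₀ ∷ a) (b₀ ∷ b) (F ∷ Fsᵢ))
                (addV-unit-suc i b₀ b) ⟨
    Φ (a₀ ∷ a) (addV (b₀ ∷ b) (unit (Fin.suc i))) (F ∷ Fs) - Φ (a₀ ∷ a) (b₀ ∷ b) (F ∷ Fsᵢ) ∎
    where Fsᵢ = Fs [ i ]%= raise₂

  δ-factors : ∀ {n} → Vec ℕ n → Vec ℕ n → Vec Test n
  δ-factors = zipWith (λ xⱼ yⱼ uⱼ vⱼ → δ _≟ℕ²_ (xⱼ , yⱼ) (uⱼ , vⱼ))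

  δ≈∏-δ-factors : ∀ {n} (x y u v : Vec ℕ n) → δ _≟Vec²_ (x , y) (u , v) ≈ ∏ (δ-factors x y) (u , v)
  δ≈∏-δ-factors []       []       []       []       = δ-≡ _≟Vec²_ {[] , []} ≡.refl
  δ≈∏-δ-factors (x ∷ xs) (y ∷ ys) (u ∷ us) (v ∷ vs) =
    trans (δ-× _≟Vec²_ _≟ℕ²_ _≟Vec²_
             {x ∷ xs , y ∷ ys} {u ∷ us , v ∷ vs} {x , y} {u , v} {xs , ys} {us , vs}
             (λ { ≡.refl → ≡.refl , ≡.refl }) (λ { ≡.refl ≡.refl → ≡.refl }))
          (*-cong refl (δ≈∏-δ-factors xs ys us vs))

  ∏-separates : ∀ {n} (v w : Vect (Vec ℕ n × Vec ℕ n)) → (∀ Fs → pair v (∏ Fs) ≈ pair w (∏ Fs)) →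
                EqV _≟Vec²_ v w
  ∏-separates v w v≈w = pair-δ-separates _≟Vec²_ v w λ (x , y) →
    trans (pair-cong v (λ (u , u′) → δ≈∏-δ-factors x y u u′))
          (trans (v≈w (δ-factors x y)) (sym (pair-cong w (λ (u , u′) → δ≈∏-δ-factors x y u u′))))

module Compatibility {c ℓ : Level} (K : CommutativeRing c ℓ) (d : ℕ) where
  open CommutativeRing K
  open Maps K d
  open ListSum K
  open Pairing K
  open ProductTests K
  open import Relation.Binary.Reasoning.Setoid setoid

  pair-ψEgen : ∀ i a h → pair (ψEgen i a) h ≈ maybe′ h 0# (lower i a)
  pair-ψEgen i a h with lookup a i
  ... | zero  = refl
  ... | suc _ = pair-⟪⟫ _ h

  pair-ψEgen² : ∀ i j a h →
                pair (ψEgen i a) (λ a′ → pair (ψEgen j a′) h) ≈ maybe′ h 0# (lower i a >>= lower j)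
  pair-ψEgen² i j a h = trans (pair-ψEgen i a _) (bind (lower i a))
    where
      bind : ∀ m → maybe′ (λ a′ → pair (ψEgen j a′) h) 0# m ≈ maybe′ h 0# (m >>= lower j)
      bind nothing   = refl
      bind (just a′) = pair-ψEgen j a′ h

  pair-ψVgen² : ∀ i j b h →
                pair (ψVgen i b) (λ b′ → pair (ψVgen j b′) h) ≈ h (addV (addV b (unit i)) (unit j))
  pair-ψVgen² i j b h = trans (pair-⟪⟫ (addV b (unit i)) (λ b′ → pair (ψVgen j b′) h))
                              (pair-⟪⟫ (addV (addV b (unit i)) (unit j)) h)

  ψE-comm : ∀ (p p′ : P) (x : D) → ψE p′ (ψE p x) ≈D ψE p (ψE p′ x)
  ψE-comm = linAct-comm _≟Idx_ ψEgen λ i j a h →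
    trans (pair-ψEgen² i j a h)
          (trans (reflexive (≡.cong (maybe′ h 0#) (lower-comm i j a))) (sym (pair-ψEgen² j i a h)))

  ψV-comm : ∀ (p p′ : P) (x : D) → ψV p (ψV p′ x) ≈D ψV p′ (ψV p x)
  ψV-comm p p′ = linAct-comm _≟Idx_ ψVgen (λ i j b h →
    trans (pair-ψVgen² i j b h)
          (trans (reflexive (≡.cong h (zipWith-rightComm ℕ._+_ ℕ+.xy∙z≈xz∙y b (unit i) (unit j))))
                 (sym (pair-ψVgen² j i b h)))) p′ p

  pair-φ : ∀ (t : D⊗D) Fs → pair (φ t) (∏ Fs) ≈ pair t (λ (a , b) → Φ a b Fs)
  pair-φ t Fs = trans (pair-linExt _ t _) (pair-cong t (λ (a , b) → reflexive (∑-map _ (below (minV a b)) _)))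

  pair-tensorL-ψE : ∀ p (t : D⊗D) h →
    pair (tensorL (ψE p) t) h ≈ pair t (λ (a , b) → pair p (λ i → maybe′ (λ a′ → h (a′ , b)) 0# (lower i a)))
  pair-tensorL-ψE p t h = trans (pair-tensorL (ψE p) t h) (pair-cong t λ (a , b) →
    let hᵇ = λ a′ → h (a′ , b) in
    trans (pair-linAct ψEgen p ⟪ a ⟫ hᵇ) (pair-cong p λ i →
      trans (pair-⟪⟫ a (λ a′ → pair (ψEgen i a′) hᵇ)) (pair-ψEgen i a hᵇ)))

  pair-tensorR-ψV : ∀ p (t : D⊗D) h →
    pair (tensorR (ψV p) t) h ≈ pair t (λ (a , b) → pair p (λ i → h (a , addV b (unit i))))
  pair-tensorR-ψV p t h = trans (pair-tensorR (ψV p) t h) (pair-cong t λ (a , b) →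
    let hₐ = λ b′ → h (a , b′) in
    trans (pair-linAct ψVgen p ⟪ b ⟫ hₐ) (pair-cong p λ i →
      trans (pair-⟪⟫ b (λ b′ → pair (ψVgen i b′) hₐ)) (pair-⟪⟫ (addV b (unit i)) hₐ)))

  pair-tensorR-ψV-φ : ∀ p (t : D⊗D) Fs →
    pair (tensorR (ψV p) (φ t)) (∏ Fs) ≈ pair t (λ (a , b) → pair p (λ i → Φ a b (Fs [ i ]%= raise₂)))
  pair-tensorR-ψV-φ p t Fs = begin
    pair (tensorR (ψV p) (φ t)) (∏ Fs)
      ≈⟨ pair-tensorR-ψV p (φ t) (∏ Fs) ⟩
    pair (φ t) (λ (u , v) → pair p (λ i → ∏ Fs (u , addV v (unit i))))
      ≈⟨ pair-cong (φ t) (λ (u , v) → pair-cong p (λ i → reflexive (∏-raise i Fs u v))) ⟩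
    pair (φ t) (λ q → pair p (λ i → ∏ (Fs [ i ]%= raise₂) q))
      ≈⟨ pair-swap (φ t) p _ ⟩
    pair p (λ i → pair (φ t) (∏ (Fs [ i ]%= raise₂)))
      ≈⟨ pair-cong p (λ i → pair-φ t (Fs [ i ]%= raise₂)) ⟩
    pair p (λ i → pair t (λ (a , b) → Φ a b (Fs [ i ]%= raise₂)))
      ≈⟨ pair-swap p t _ ⟩
    pair t (λ (a , b) → pair p (λ i → Φ a b (Fs [ i ]%= raise₂))) ∎

  φ-compatible : ∀ (p : P) (t : D⊗D) → φ (tensorL (ψE p) t) ≈T (φ (tensorR (ψV p) t) ⊖ tensorR (ψV p) (φ t))
  φ-compatible p t =
    ∏-separates (φ (tensorL (ψE p) t)) (φ (tensorR (ψV p) t) ⊖ tensorR (ψV p) (φ t)) λ Fs → begin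
    pair (φ (tensorL (ψE p) t)) (∏ Fs)
      ≈⟨ trans (pair-φ (tensorL (ψE p) t) Fs) (pair-tensorL-ψE p t _) ⟩
    pair t (λ (a , b) → pair p (λ i → maybe′ (λ a′ → Φ a′ b Fs) 0# (lower i a)))
      ≈⟨ pair-cong t (λ (a , b) → pair-cong p (λ i → Φ-lower i a b Fs)) ⟩
    pair t (λ (a , b) → pair p (λ i → Φ a (addV b (unit i)) Fs - Φ a b (Fs [ i ]%= raise₂)))
      ≈⟨ trans (pair-cong t (λ _ → pair-- p _ _)) (pair-- t _ _) ⟩
    pair t (λ (a , b) → pair p (λ i → Φ a (addV b (unit i)) Fs))
      - pair t (λ (a , b) → pair p (λ i → Φ a b (Fs [ i ]%= raise₂)))
      ≈⟨ -cong (trans (pair-φ (tensorR (ψV p) t) Fs) (pair-tensorR-ψV p t _)) (pair-tensorR-ψV-φ p t Fs) ⟨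
    pair (φ (tensorR (ψV p) t)) (∏ Fs) - pair (tensorR (ψV p) (φ t)) (∏ Fs)
      ≈⟨ pair-⊖ (φ (tensorR (ψV p) t)) (tensorR (ψV p) (φ t)) (∏ Fs) ⟨
    pair (φ (tensorR (ψV p) t) ⊖ tensorR (ψV p) (φ t)) (∏ Fs) ∎

proposition4p7 : {c ℓ : Level} (K : CommutativeRing c ℓ) → IsCharZeroField K → (d : ℕ) →
    let open Maps K d in
      (∀ (p p′ : P) (x : D) → ψE p′ (ψE p x) ≈D ψE p (ψE p′ x))
      × (∀ (p p′ : P) (x : D) → ψV p (ψV p′ x) ≈D ψV p′ (ψV p x))
      × (∀ (p : P) (t : D⊗D) →
           φ (tensorL (ψE p) t) ≈T (φ (tensorR (ψV p) t) ⊖ tensorR (ψV p) (φ t)))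
proposition4p7 K _ d = ψE-comm , ψV-comm , φ-compatible
  where open Compatibility K d
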